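{- If $P_\infty$ is the two-way infinite path, then $\mathrm{mob}(P_\infty\,\square\, P_\infty)=4$.
   Context: $P_\infty$ has vertex set $\mathbb{Z}$ with $i\sim i+1$; $P_\infty\,\square\,P_\infty$ is the infinite grid on $\mathbb{Z}^2$ (Cartesian product). A set $S$ of vertices is a general position set if no three vertices of $S$ lie on a common shortest path. Robots are placed one per vertex of a general position set $S$; a move $u\to v$ along an edge $uv$ with $u\in S$ is legal if $v\notin S$ and $(S\setminus\{u\})\cup\{v\}$ is a general position set. $S$ is a mobile general position set if there is a (possibly infinite) sequence of legal moves starting from $S$ such that every vertex is visited at least once by some robot; $\mathrm{mob}(G)$ is the maximum size of a mobile general position set. -}

module Defs where

open import Data.Nat using (ℕ; zero; suc; _≤_)
open import Data.Integer using (ℤ; _+_; 1ℤ)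
open import Data.Fin using (Fin)
open import Data.Product using (Σ; ∃; _×_; _,_)
open import Data.Sum using (_⊎_)
open import Data.List using (List; []; _∷_)
open import Data.List.Membership.Propositional using (_∈_)
open import Relation.Binary.PropositionalEquality using (_≡_; _≢_)
open import Relation.Nullary using (¬_)
open import Function.Definitions using (Injective)

AdjP : ℤ → ℤ → Set
AdjP i j = (j ≡ i + 1ℤ) ⊎ (i ≡ j + 1ℤ)

V : Set
V = ℤ × ℤ

Adj : V → V → Set
Adj (a , b) (c , d) = (a ≡ c × AdjP b d) ⊎ (b ≡ d × AdjP a c)

data Path : V → V → ℕ → Set where
  nil  : ∀ {u} → Path u u 0
  cons : ∀ {u w v n} → Adj u w → Path w v n → Path u v (suc n)

vertices : ∀ {u v n} → Path u v n → List V
vertices {u} nil = u ∷ []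
vertices {u} (cons _ p) = u ∷ vertices p

IsShortest : ∀ {u v n} → Path u v n → Set
IsShortest {u} {v} {n} _ = ∀ m → Path u v m → n ≤ m

OnCommonShortestPath : V → V → V → Set
OnCommonShortestPath x y z =
  Σ V λ u → Σ V λ v → Σ ℕ λ n → Σ (Path u v n) λ p →
    IsShortest p × x ∈ vertices p × y ∈ vertices p × z ∈ vertices p

-- A set of k vertices, given as an injective labelling Fin k → V
-- (robot i sits on vertex c i), is in general position.
GeneralPosition : ∀ {k} → (Fin k → V) → Set
GeneralPosition {k} c =
  Injective _≡_ _≡_ c ×
  (∀ (i j l : Fin k) → i ≢ j → j ≢ l → i ≢ l →
     ¬ OnCommonShortestPath (c i) (c j) (c l))

LegalMove : ∀ {k} → (Fin k → V) → (Fin k → V) → Set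
LegalMove {k} c c' =
  Σ (Fin k) λ i → Σ V λ v →
    Adj (c i) v × (∀ j → c j ≢ v) ×
    c' i ≡ v × (∀ j → j ≢ i → c' j ≡ c j) ×
    GeneralPosition c'

-- One step of a (possibly finite) move sequence: a legal move, or
-- nothing happens (used to pad finite sequences to infinite ones).
Step : ∀ {k} → (Fin k → V) → (Fin k → V) → Set
Step c c' = LegalMove c c' ⊎ (∀ j → c' j ≡ c j)

Mobile : ∀ {k} → (Fin k → V) → Set
Mobile {k} S =
  GeneralPosition S ×
  Σ (ℕ → Fin k → V) λ seq →
    (∀ j → seq 0 j ≡ S j) ×
    (∀ t → Step (seq t) (seq (suc t))) ×
    (∀ (w : V) → Σ ℕ λ t → Σ (Fin k) λ i → seq t i ≡ w)

{-# OPTIONS --safe #-}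

-- Three vertices of the grid lie on a common shortest path exactly when one of them lies between
-- the other two for the ℓ¹ distance d, i.e. d(x,y) + d(y,z) = d(x,z): along a shortest path every
-- segment is a geodesic.
--
-- At most four: coordinatewise monotone chains are metric, so a set in general position has no
-- three-element chain in the north-east order ≤ₙₑ, nor in the south-east order ≤ₛₑ. Label each
-- point by whether it has a ≤ₙₑ-predecessor in the set; two points with the same label are
-- ≤ₙₑ-incomparable (a predecessor of the smaller one would close a chain of three), hence
-- ≤ₛₑ-comparable. Refining each label class by the same test for ≤ₛₑ makes the labelling
-- injective into Bool × Bool.
--
-- Four are mobile: the formation {(-3,-2), (-2,-3), (-1,1), (0,0)} can be shifted by one step in
-- each direction by moving its robots one at a time, in an order depending on the direction,
-- through configurations in general position only (a finite check, done by evaluation). Shifting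
-- it along routes between the successive points of an enumeration of ℤ², the robot at the origin
-- of the formation visits every vertex.

module Submission where

open import Data.Bool using (Bool; true; false)
import Data.Bool.Properties as Bool
open import Data.Empty using (⊥-elim)
open import Data.Fin using (Fin; combine)
open import Data.Fin.Patterns using (0F; 1F; 2F; 3F)
open import Data.Fin.Properties using (any?; all?; combine-injective; injective⇒≤; 2↔Bool)
  renaming (_≟_ to _≟ᶠ_)
open import Data.Integer as ℤ using (ℤ; +_; -[1+_]; ∣_∣; 0ℤ; 1ℤ; -1ℤ; _-_)
  renaming (_≤_ to _≤ᶻ_)
import Data.Integer.Properties as ℤ
open import Algebra.Properties.AbelianGroup ℤ.+-0-abelianGroup using (∙-cancelˡ)
open import Data.Integer.Tactic.RingSolver using (solve-∀)
open import Data.List using (List; []; _∷_; _++_; length)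
open import Data.List.Properties using (length-++)
open import Data.List.Membership.Propositional using (_∈_)
open import Data.List.Relation.Unary.Any using (here; there)
open import Data.Nat using (ℕ; zero; suc; _+_; _≤_; s≤s)
open import Data.Nat.Properties
  using (≤-trans; ≤-reflexive; ≤-antisym; +-mono-≤; +-cancelˡ-≤; +-cancelʳ-≤; +-assoc; +-comm;
         +-suc; +-identityʳ; 0≢1+n; +-commutativeSemigroup; module ≤-Reasoning)
  renaming (_≟_ to _≟ⁿ_)
open import Algebra.Properties.CommutativeSemigroup +-commutativeSemigroup using (interchange)
open import Data.Product as Product using (Σ; ∃; _×_; _,_; proj₁; proj₂)
open import Data.Product.Properties using (≡-dec)
open import Data.Sum as Sum using (_⊎_; inj₁; inj₂)
open import Data.Unit using (⊤; tt)
import Data.Unit.Properties as Unit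
open import Data.Vec.Functional using (updateAt)
open import Data.Vec.Functional.Properties using (updateAt-updates; updateAt-minimal)
open import Function.Base using (_∘_; _$_; const)
open import Function.Bundles using (_⇔_; mk⇔; Equivalence; Inverse; Injection)
open import Function.Definitions using (Injective)
open import Function.Properties.Inverse using (↔-sym; ↔⇒↣)
open import Relation.Binary.Construct.Closure.ReflexiveTransitive using (Star; ε; _◅_; _◅◅_)
open import Relation.Binary.Definitions using (DecidableEquality)
open import Relation.Binary.PropositionalEquality
open import Relation.Nullary using (¬_; Dec; yes; no; does)
open import Relation.Nullary.Decidable
  using (_×-dec_; ¬?; _→-dec_; map′; from-yes; dec-true; dec-false)

open import Defs

variable
  u v w x y z : V
  k m n : ℕ

-- The grid metric

infixl 6 _⊕_
_⊕_ : V → V → V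
(a , b) ⊕ (c , d) = (a ℤ.+ c , b ℤ.+ d)

dist : V → V → ℕ
dist (a , b) (c , d) = ∣ c - a ∣ + ∣ d - b ∣

data Direction : Set where
  east west north south : Direction

unit : Direction → V
unit east  = (1ℤ , 0ℤ)
unit west  = (-1ℤ , 0ℤ)
unit north = (0ℤ , 1ℤ)
unit south = (0ℤ , -1ℤ)

adjP-pred : ∀ a → AdjP a (a ℤ.+ -1ℤ)
adjP-pred a = inj₂ (a≡a-1+1 a)
  where a≡a-1+1 : ∀ a → a ≡ (a ℤ.+ -1ℤ) ℤ.+ 1ℤ
        a≡a-1+1 = solve-∀

adj-unit : ∀ p d → Adj p (p ⊕ unit d)
adj-unit (a , b) east  = inj₂ (sym (ℤ.+-identityʳ b) , inj₁ refl)
adj-unit (a , b) west  = inj₂ (sym (ℤ.+-identityʳ b) , adjP-pred a)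
adj-unit (a , b) north = inj₁ (sym (ℤ.+-identityʳ a) , inj₁ refl)
adj-unit (a , b) south = inj₁ (sym (ℤ.+-identityʳ a) , adjP-pred b)

follow : V → List Direction → V
follow p []      = p
follow p (d ∷ L) = follow (p ⊕ unit d) L

follow-path : ∀ p L → Path p (follow p L) (length L)
follow-path p []      = nil
follow-path p (d ∷ L) = cons (adj-unit p d) (follow-path (p ⊕ unit d) L)

follow-++ : ∀ p L M → follow p (L ++ M) ≡ follow (follow p L) M
follow-++ p []      M = refl
follow-++ p (d ∷ L) M = follow-++ (p ⊕ unit d) L M

xLine yLine : ℤ → List Direction
xLine (+ zero)         = []
xLine (+ suc n)        = east ∷ xLine (+ n)
xLine -[1+ zero ]      = west ∷ []
xLine -[1+ suc n ]     = west ∷ xLine -[1+ n ]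
yLine (+ zero)         = []
yLine (+ suc n)        = north ∷ yLine (+ n)
yLine -[1+ zero ]      = south ∷ []
yLine -[1+ suc n ]     = south ∷ yLine -[1+ n ]

length-xLine : ∀ δ → length (xLine δ) ≡ ∣ δ ∣
length-xLine (+ zero)     = refl
length-xLine (+ suc n)    = cong suc (length-xLine (+ n))
length-xLine -[1+ zero ]  = refl
length-xLine -[1+ suc n ] = cong suc (length-xLine -[1+ n ])

length-yLine : ∀ δ → length (yLine δ) ≡ ∣ δ ∣
length-yLine (+ zero)     = refl
length-yLine (+ suc n)    = cong suc (length-yLine (+ n))
length-yLine -[1+ zero ]  = refl
length-yLine -[1+ suc n ] = cong suc (length-yLine -[1+ n ])

follow-xLine : ∀ a b δ → follow (a , b) (xLine δ) ≡ (a ℤ.+ δ , b)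
follow-xLine a b (+ zero)     = cong (_, b) (sym (ℤ.+-identityʳ a))
follow-xLine a b (+ suc n)    = trans (follow-xLine (a ℤ.+ 1ℤ) (b ℤ.+ 0ℤ) (+ n))
  (cong₂ _,_ (ℤ.+-assoc a 1ℤ (+ n)) (ℤ.+-identityʳ b))
follow-xLine a b -[1+ zero ]  = cong (a ℤ.+ -1ℤ ,_) (ℤ.+-identityʳ b)
follow-xLine a b -[1+ suc n ] = trans (follow-xLine (a ℤ.+ -1ℤ) (b ℤ.+ 0ℤ) -[1+ n ])
  (cong₂ _,_ (ℤ.+-assoc a -1ℤ -[1+ n ]) (ℤ.+-identityʳ b))

follow-yLine : ∀ a b δ → follow (a , b) (yLine δ) ≡ (a , b ℤ.+ δ)
follow-yLine a b (+ zero)     = cong (a ,_) (sym (ℤ.+-identityʳ b))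
follow-yLine a b (+ suc n)    = trans (follow-yLine (a ℤ.+ 0ℤ) (b ℤ.+ 1ℤ) (+ n))
  (cong₂ _,_ (ℤ.+-identityʳ a) (ℤ.+-assoc b 1ℤ (+ n)))
follow-yLine a b -[1+ zero ]  = cong (_, b ℤ.+ -1ℤ) (ℤ.+-identityʳ a)
follow-yLine a b -[1+ suc n ] = trans (follow-yLine (a ℤ.+ 0ℤ) (b ℤ.+ -1ℤ) -[1+ n ])
  (cong₂ _,_ (ℤ.+-identityʳ a) (ℤ.+-assoc b -1ℤ -[1+ n ]))

route : V → V → List Direction
route (a , b) (c , d) = xLine (c - a) ++ yLine (d - b)

follow-route : ∀ p q → follow p (route p q) ≡ q
follow-route (a , b) (c , d) = begin
  follow (a , b) (xLine (c - a) ++ yLine (d - b))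
    ≡⟨ follow-++ (a , b) (xLine (c - a)) (yLine (d - b)) ⟩
  follow (follow (a , b) (xLine (c - a))) (yLine (d - b))
    ≡⟨ cong (λ p → follow p (yLine (d - b))) (follow-xLine a b (c - a)) ⟩
  follow (a ℤ.+ (c - a) , b) (yLine (d - b))
    ≡⟨ follow-yLine (a ℤ.+ (c - a)) b (d - b) ⟩
  (a ℤ.+ (c - a) , b ℤ.+ (d - b))
    ≡⟨ cong₂ _,_ (a+[c-a]≡c a c) (a+[c-a]≡c b d) ⟩
  (c , d)
    ∎
  where open ≡-Reasoning
        a+[c-a]≡c : ∀ a c → a ℤ.+ (c - a) ≡ c
        a+[c-a]≡c = solve-∀

length-route : ∀ p q → length (route p q) ≡ dist p q
length-route (a , b) (c , d) = trans (length-++ (xLine (c - a)))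
  (cong₂ _+_ (length-xLine (c - a)) (length-yLine (d - b)))

geodesic : ∀ p q → Path p q (dist p q)
geodesic p q = subst₂ (Path p) (follow-route p q) (length-route p q) (follow-path p (route p q))

[b-a]+[c-b]≡c-a : ∀ a b c → (b - a) ℤ.+ (c - b) ≡ c - a
[b-a]+[c-b]≡c-a = solve-∀

∣-∣-triangle : ∀ a b c → ∣ c - a ∣ ≤ ∣ b - a ∣ + ∣ c - b ∣
∣-∣-triangle a b c =
  subst (λ δ → ∣ δ ∣ ≤ ∣ b - a ∣ + ∣ c - b ∣) ([b-a]+[c-b]≡c-a a b c)
        (ℤ.∣i+j∣≤∣i∣+∣j∣ (b - a) (c - b))

∣a-a∣≡0 : ∀ a → ∣ a - a ∣ ≡ 0
∣a-a∣≡0 a = cong ∣_∣ (ℤ.+-inverseʳ a)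

adjP⇒∣-∣≡1 : ∀ {a b} → AdjP a b → ∣ b - a ∣ ≡ 1
adjP⇒∣-∣≡1 {a} (inj₁ refl) = cong ∣_∣ ([a+1]-a≡1 a)
  where [a+1]-a≡1 : ∀ a → (a ℤ.+ 1ℤ) - a ≡ 1ℤ
        [a+1]-a≡1 = solve-∀
adjP⇒∣-∣≡1 {b = b} (inj₂ refl) = cong ∣_∣ (b-[b+1]≡-1 b)
  where b-[b+1]≡-1 : ∀ b → b - (b ℤ.+ 1ℤ) ≡ -1ℤ
        b-[b+1]≡-1 = solve-∀

dist-self : ∀ p → dist p p ≡ 0
dist-self (a , b) = cong₂ _+_ (∣a-a∣≡0 a) (∣a-a∣≡0 b)

dist-sym : ∀ p q → dist p q ≡ dist q p
dist-sym (a , b) (c , d) = cong₂ _+_ (ℤ.∣i-j∣≡∣j-i∣ c a) (ℤ.∣i-j∣≡∣j-i∣ d b)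

dist-triangle : ∀ p q r → dist p r ≤ dist p q + dist q r
dist-triangle (a , b) (c , d) (e , f) = ≤-trans
  (+-mono-≤ (∣-∣-triangle a c e) (∣-∣-triangle b d f))
  (≤-reflexive (interchange (∣ c - a ∣) (∣ e - c ∣) (∣ d - b ∣) (∣ f - d ∣)))

adj⇒dist≡1 : Adj u v → dist u v ≡ 1
adj⇒dist≡1 {a , _} (inj₁ (refl , b∼d)) = cong₂ _+_ (∣a-a∣≡0 a) (adjP⇒∣-∣≡1 b∼d)
adj⇒dist≡1 {_ , b} (inj₂ (refl , a∼c)) = cong₂ _+_ (adjP⇒∣-∣≡1 a∼c) (∣a-a∣≡0 b)

dist≤length : Path u v n → dist u v ≤ n
dist≤length {u} nil = ≤-reflexive (dist-self u)
dist≤length {u} {v} {suc n} (cons {w = w} u∼w p) = ≤-trans (dist-triangle u w v)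
  (subst (λ d → d + dist w v ≤ suc n) (sym (adj⇒dist≡1 u∼w)) (s≤s (dist≤length p)))

-- Shortest paths and betweenness

infixr 5 _++ᵖ_
_++ᵖ_ : Path u w m → Path w v n → Path u v (m + n)
nil      ++ᵖ q = q
cons e p ++ᵖ q = cons e (p ++ᵖ q)

∈-head : (p : Path u v n) → u ∈ vertices p
∈-head nil        = here refl
∈-head (cons _ _) = here refl

∈-last : (p : Path u v n) → v ∈ vertices p
∈-last nil        = here refl
∈-last (cons _ p) = there (∈-last p)

∈-++ᵖʳ : (p : Path u w m) (q : Path w v n) → x ∈ vertices q → x ∈ vertices (p ++ᵖ q)
∈-++ᵖʳ nil        q x∈q = x∈q
∈-++ᵖʳ (cons _ p) q x∈q = there (∈-++ᵖʳ p q x∈q)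

record Between (x y z : V) : Set where
  constructor between
  field
    dist-≡ : dist x y + dist y z ≡ dist x z

between-sym : Between x y z → Between z y x
between-sym {x} {y} {z} (between x-y-z) = between $ begin
  dist z y + dist y x ≡⟨ cong₂ _+_ (dist-sym z y) (dist-sym y x) ⟩
  dist y z + dist x y ≡⟨ +-comm (dist y z) (dist x y) ⟩
  dist x y + dist y z ≡⟨ x-y-z ⟩
  dist x z            ≡⟨ dist-sym x z ⟩
  dist z x            ∎
  where open ≡-Reasoning

between-chain : Between u x y → Between u y z → Between x y z
between-chain {u} {x} {y} {z} (between u-x-y) (between u-y-z) = between $
  ≤-antisym (+-cancelˡ-≤ (dist u x) _ _ detour) (dist-triangle x y z)
  where
  open ≤-Reasoning
  detour : dist u x + (dist x y + dist y z) ≤ dist u x + dist x z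
  detour = begin
    dist u x + (dist x y + dist y z) ≡⟨ sym (+-assoc (dist u x) (dist x y) (dist y z)) ⟩
    dist u x + dist x y + dist y z   ≡⟨ cong (_+ dist y z) u-x-y ⟩
    dist u y + dist y z              ≡⟨ u-y-z ⟩
    dist u z                         ≤⟨ dist-triangle u x z ⟩
    dist u x + dist x z              ∎

between⇒onCommonShortestPath : Between x y z → OnCommonShortestPath x y z
between⇒onCommonShortestPath {x} {y} {z} (between x-y-z) =
  x , z , _ , x⇝y⇝z , shortest , ∈-head x⇝y⇝z ,
  ∈-++ᵖʳ (geodesic x y) (geodesic y z) (∈-head (geodesic y z)) ,
  ∈-++ᵖʳ (geodesic x y) (geodesic y z) (∈-last (geodesic y z))
  where
  x⇝y⇝z : Path x z (dist x y + dist y z)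
  x⇝y⇝z = geodesic x y ++ᵖ geodesic y z
  shortest : IsShortest x⇝y⇝z
  shortest m q = subst (_≤ m) (sym x-y-z) (dist≤length q)

record Split (u x v : V) (n : ℕ) : Set where
  constructor split
  field
    {l₁ l₂} : ℕ
    u⇝x     : Path u x l₁
    x⇝v     : Path x v l₂
    length≡ : l₁ + l₂ ≡ n

∈-split : (p : Path u v n) → x ∈ vertices p → Split u x v n
∈-split nil        (here refl) = split nil nil refl
∈-split (cons e p) (here refl) = split nil (cons e p) refl
∈-split (cons e p) (there x∈p) with ∈-split p x∈p
... | split q r eq = split (cons e q) r (cong suc eq)

record Through (u x y v : V) (n : ℕ) : Set where
  constructor through
  field
    {l₁ l₂ l₃} : ℕ
    u⇝x        : Path u x l₁
    x⇝y        : Path x y l₂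
    y⇝v        : Path y v l₃
    length≡    : l₁ + l₂ + l₃ ≡ n

split⇒through : Split u x v n → Through u u x v n
split⇒through (split q r eq) = through nil q r eq

∈-order : (p : Path u v n) → x ∈ vertices p → y ∈ vertices p → Through u x y v n ⊎ Through u y x v n
∈-order nil        (here refl) (here refl) = inj₁ (through nil nil nil refl)
∈-order (cons e p) (here refl) y∈p         = inj₁ (split⇒through (∈-split (cons e p) y∈p))
∈-order (cons e p) (there x∈p) (here refl) = inj₂ (split⇒through (∈-split (cons e p) (there x∈p)))
∈-order (cons e p) (there x∈p) (there y∈p) = Sum.map prepend prepend (∈-order p x∈p y∈p)
  where
  prepend : Through _ x y _ _ → Through _ x y _ _
  prepend (through q r s eq) = through (cons e q) r s (cong suc eq)

shortest-through⇒between : (p : Path u v n) → IsShortest p → Through u x y v n → Between u x y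
shortest-through⇒between {u} {x = x} {y} p shortest (through {l₁} {l₂} {l₃} q r s refl) = between $
  ≤-antisym (≤-trans (+-mono-≤ (dist≤length q) (dist≤length r)) l₁+l₂≤dist)
            (dist-triangle u x y)
  where
  l₁+l₂≤dist : l₁ + l₂ ≤ dist u y
  l₁+l₂≤dist = +-cancelʳ-≤ l₃ (l₁ + l₂) (dist u y) (shortest _ (geodesic u y ++ᵖ s))

Aligned : V → V → V → Set
Aligned x y z = Between y x z ⊎ Between x y z ⊎ Between x z y

onCommonShortestPath⇒aligned : OnCommonShortestPath x y z → Aligned x y z
onCommonShortestPath⇒aligned {x} {y} {z} (u , v , n , p , shortest , x∈p , y∈p , z∈p) =
  sort (compare x∈p y∈p) (compare y∈p z∈p) (compare x∈p z∈p)
  where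
  compare : ∀ {a b} → a ∈ vertices p → b ∈ vertices p → Between u a b ⊎ Between u b a
  compare a∈p b∈p = Sum.map (shortest-through⇒between p shortest)
                            (shortest-through⇒between p shortest) (∈-order p a∈p b∈p)
  sort : Between u x y ⊎ Between u y x → Between u y z ⊎ Between u z y →
         Between u x z ⊎ Between u z x → Aligned x y z
  sort (inj₁ xy) (inj₁ yz) _         = inj₂ (inj₁ (between-chain xy yz))
  sort (inj₂ yx) (inj₂ zy) _         = inj₂ (inj₁ (between-sym (between-chain zy yx)))
  sort (inj₁ _)  (inj₂ zy) (inj₁ xz) = inj₂ (inj₂ (between-chain xz zy))
  sort (inj₁ xy) (inj₂ _)  (inj₂ zx) = inj₁ (between-sym (between-chain zx xy))
  sort (inj₂ yx) (inj₁ _)  (inj₁ xz) = inj₁ (between-chain yx xz)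
  sort (inj₂ _)  (inj₁ yz) (inj₂ zx) = inj₂ (inj₂ (between-sym (between-chain yz zx)))

NoThreeBetween : (Fin k → V) → Set
NoThreeBetween c = ∀ i j l → i ≢ j → j ≢ l → i ≢ l → ¬ Between (c i) (c j) (c l)

Separated : (Fin k → V) → Set
Separated c = Injective _≡_ _≡_ c × NoThreeBetween c

generalPosition⇔separated : (c : Fin k → V) → GeneralPosition c ⇔ Separated c
generalPosition⇔separated c = mk⇔
  (λ (injective , noPath) → injective , λ i j l i≢j j≢l i≢l →
     noPath i j l i≢j j≢l i≢l ∘ between⇒onCommonShortestPath)
  (λ (injective , noBetween) → injective , λ i j l i≢j j≢l i≢l →
     Sum.[ noBetween j i l (≢-sym i≢j) i≢l j≢l
         , Sum.[ noBetween i j l i≢j j≢l i≢l , noBetween i l j i≢l (≢-sym j≢l) i≢j ] ]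
     ∘ onCommonShortestPath⇒aligned)

-- At most four points in general position

∣-∣-additive : ∀ {a b c} → a ≤ᶻ b → b ≤ᶻ c → ∣ b - a ∣ + ∣ c - b ∣ ≡ ∣ c - a ∣
∣-∣-additive {a} {b} {c} a≤b b≤c = ℤ.+-injective $ begin
  + (∣ b - a ∣ + ∣ c - b ∣)     ≡⟨ ℤ.pos-+ ∣ b - a ∣ ∣ c - b ∣ ⟩
  + ∣ b - a ∣ ℤ.+ + ∣ c - b ∣   ≡⟨ cong₂ ℤ._+_ (+∣-∣≡ a≤b) (+∣-∣≡ b≤c) ⟩
  (b - a) ℤ.+ (c - b)           ≡⟨ [b-a]+[c-b]≡c-a a b c ⟩
  c - a                         ≡⟨ +∣-∣≡ (ℤ.≤-trans a≤b b≤c) ⟨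
  + ∣ c - a ∣                   ∎
  where
  open ≡-Reasoning
  +∣-∣≡ : ∀ {x y} → x ≤ᶻ y → + ∣ y - x ∣ ≡ y - x
  +∣-∣≡ = ℤ.0≤i⇒+∣i∣≡i ∘ ℤ.i≤j⇒0≤j-i

∣-∣-additive-reversed : ∀ {a b c} → c ≤ᶻ b → b ≤ᶻ a → ∣ b - a ∣ + ∣ c - b ∣ ≡ ∣ c - a ∣
∣-∣-additive-reversed {a} {b} {c} c≤b b≤a = begin
  ∣ b - a ∣ + ∣ c - b ∣ ≡⟨ cong₂ _+_ (ℤ.∣i-j∣≡∣j-i∣ b a) (ℤ.∣i-j∣≡∣j-i∣ c b) ⟩
  ∣ a - b ∣ + ∣ b - c ∣ ≡⟨ +-comm (∣ a - b ∣) (∣ b - c ∣) ⟩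
  ∣ b - c ∣ + ∣ a - b ∣ ≡⟨ ∣-∣-additive c≤b b≤a ⟩
  ∣ a - c ∣             ≡⟨ ℤ.∣i-j∣≡∣j-i∣ a c ⟩
  ∣ c - a ∣             ∎
  where open ≡-Reasoning

between-coordinatewise : ∀ {a₁ a₂ b₁ b₂ c₁ c₂} →
  ∣ b₁ - a₁ ∣ + ∣ c₁ - b₁ ∣ ≡ ∣ c₁ - a₁ ∣ → ∣ b₂ - a₂ ∣ + ∣ c₂ - b₂ ∣ ≡ ∣ c₂ - a₂ ∣ →
  Between (a₁ , a₂) (b₁ , b₂) (c₁ , c₂)
between-coordinatewise {a₁} {a₂} {b₁} {b₂} {c₁} {c₂} e₁ e₂ = between $
  trans (interchange (∣ b₁ - a₁ ∣) (∣ b₂ - a₂ ∣) (∣ c₁ - b₁ ∣) (∣ c₂ - b₂ ∣)) (cong₂ _+_ e₁ e₂)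

infix 4 _≤ₙₑ_ _≤ₛₑ_
_≤ₙₑ_ _≤ₛₑ_ : V → V → Set
(a , b) ≤ₙₑ (c , d) = a ≤ᶻ c × b ≤ᶻ d
(a , b) ≤ₛₑ (c , d) = a ≤ᶻ c × d ≤ᶻ b

_≤ₙₑ?_ : ∀ p q → Dec (p ≤ₙₑ q)
(a , b) ≤ₙₑ? (c , d) = (a ℤ.≤? c) ×-dec (b ℤ.≤? d)

_≤ₛₑ?_ : ∀ p q → Dec (p ≤ₛₑ q)
(a , b) ≤ₛₑ? (c , d) = (a ℤ.≤? c) ×-dec (d ℤ.≤? b)

≤ₙₑ-antisym : ∀ {p q} → p ≤ₙₑ q → q ≤ₙₑ p → p ≡ q
≤ₙₑ-antisym {_ , _} {_ , _} (a≤c , b≤d) (c≤a , d≤b) =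
  cong₂ _,_ (ℤ.≤-antisym a≤c c≤a) (ℤ.≤-antisym b≤d d≤b)

≤ₛₑ-antisym : ∀ {p q} → p ≤ₛₑ q → q ≤ₛₑ p → p ≡ q
≤ₛₑ-antisym {_ , _} {_ , _} (a≤c , d≤b) (c≤a , b≤d) =
  cong₂ _,_ (ℤ.≤-antisym a≤c c≤a) (ℤ.≤-antisym b≤d d≤b)

≤ₙₑ-between : ∀ {p q r} → p ≤ₙₑ q → q ≤ₙₑ r → Between p q r
≤ₙₑ-between {_ , _} {_ , _} {_ , _} (x₁ , y₁) (x₂ , y₂) =
  between-coordinatewise (∣-∣-additive x₁ x₂) (∣-∣-additive y₁ y₂)

≤ₛₑ-between : ∀ {p q r} → p ≤ₛₑ q → q ≤ₛₑ r → Between p q r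
≤ₛₑ-between {_ , _} {_ , _} {_ , _} (x₁ , y₁) (x₂ , y₂) =
  between-coordinatewise (∣-∣-additive x₁ x₂) (∣-∣-additive-reversed y₂ y₁)

≰ₙₑ⇒≤ₛₑ : ∀ {p q} → ¬ p ≤ₙₑ q → ¬ q ≤ₙₑ p → p ≤ₛₑ q ⊎ q ≤ₛₑ p
≰ₙₑ⇒≤ₛₑ {a , b} {c , d} p≰q q≰p with ℤ.≤-total a c | ℤ.≤-total b d
... | inj₁ a≤c | inj₁ b≤d = ⊥-elim (p≰q (a≤c , b≤d))
... | inj₁ a≤c | inj₂ d≤b = inj₁ (a≤c , d≤b)
... | inj₂ c≤a | inj₁ b≤d = inj₂ (c≤a , b≤d)
... | inj₂ c≤a | inj₂ d≤b = ⊥-elim (q≰p (c≤a , d≤b))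

module Layers
  {A : Set} (_≟ᴬ_ : DecidableEquality A)
  (_≼_ : V → V → Set) (_≼?_ : ∀ p q → Dec (p ≼ q))
  (≼-between : ∀ {p q r} → p ≼ q → q ≼ r → Between p q r)
  (≼-antisym : ∀ {p q} → p ≼ q → q ≼ p → p ≡ q)
  (c : Fin k → V) (injective : Injective _≡_ _≡_ c) (noBetween : NoThreeBetween c)
  (label : Fin k → A)
  where

  HasPredecessor : Fin k → Set
  HasPredecessor i = ∃ λ q → label q ≡ label i × q ≢ i × c q ≼ c i

  hasPredecessor? : ∀ i → Dec (HasPredecessor i)
  hasPredecessor? i = any? λ q → (label q ≟ᴬ label i) ×-dec ¬? (q ≟ᶠ i) ×-dec (c q ≼? c i)

  layer : Fin k → Bool
  layer = does ∘ hasPredecessor?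

  same-layer⇒incomparable : ∀ {i j} → label i ≡ label j → i ≢ j → layer i ≡ layer j → ¬ c i ≼ c j
  same-layer⇒incomparable {i} {j} same-label i≢j same-layer ci≼cj =
    false≢true (begin
      false   ≡⟨ dec-false (hasPredecessor? i) minimal ⟨
      layer i ≡⟨ same-layer ⟩
      layer j ≡⟨ dec-true (hasPredecessor? j) (i , same-label , i≢j , ci≼cj) ⟩
      true    ∎)
    where
    open ≡-Reasoning
    false≢true : false ≢ true
    false≢true ()
    minimal : ¬ HasPredecessor i
    minimal (q , _ , q≢i , cq≼ci) with q ≟ᶠ j
    ... | yes refl = i≢j (injective (≼-antisym ci≼cj cq≼ci))
    ... | no q≢j   = noBetween q i j q≢i i≢j q≢j (≼-between cq≼ci ci≼cj)

generalPosition⇒≤4 : (c : Fin k → V) → GeneralPosition c → k ≤ 4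
generalPosition⇒≤4 {k} c gp = injective⇒≤ key-injective
  where
  injective : Injective _≡_ _≡_ c
  injective = proj₁ (Equivalence.to (generalPosition⇔separated c) gp)
  noBetween : NoThreeBetween c
  noBetween = proj₂ (Equivalence.to (generalPosition⇔separated c) gp)
  module L₁ = Layers Unit._≟_ _≤ₙₑ_ _≤ₙₑ?_ ≤ₙₑ-between ≤ₙₑ-antisym c injective noBetween (const tt)
  module L₂ = Layers Bool._≟_ _≤ₛₑ_ _≤ₛₑ?_ ≤ₛₑ-between ≤ₛₑ-antisym c injective noBetween L₁.layer
  bit : Bool → Fin 2
  bit = Inverse.from 2↔Bool
  key : Fin k → Fin 4
  key i = combine (bit (L₁.layer i)) (bit (L₂.layer i))
  bit-injective : Injective _≡_ _≡_ bit
  bit-injective = Injection.injective (↔⇒↣ (↔-sym 2↔Bool))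
  same-layers⇒≡ : ∀ {i j} → L₁.layer i ≡ L₁.layer j → L₂.layer i ≡ L₂.layer j → i ≡ j
  same-layers⇒≡ {i} {j} layer₁≡ layer₂≡ with i ≟ᶠ j
  ... | yes i≡j = i≡j
  ... | no i≢j  = ⊥-elim (Sum.[ L₂.same-layer⇒incomparable layer₁≡ i≢j layer₂≡
                              , L₂.same-layer⇒incomparable (sym layer₁≡) (≢-sym i≢j) (sym layer₂≡) ]
                              (≰ₙₑ⇒≤ₛₑ (L₁.same-layer⇒incomparable refl i≢j layer₁≡)
                                       (L₁.same-layer⇒incomparable refl (≢-sym i≢j) (sym layer₁≡))))
  key-injective : Injective _≡_ _≡_ key
  key-injective {i} {j} key≡ =
    Product.uncurry same-layers⇒≡ $ Product.map bit-injective bit-injective $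
    combine-injective (bit (L₁.layer i)) (bit (L₂.layer i)) (bit (L₁.layer j)) (bit (L₂.layer j))
                      key≡

-- Shifting the formation

⊕-assoc : ∀ p q r → p ⊕ q ⊕ r ≡ p ⊕ (q ⊕ r)
⊕-assoc (a , b) (c , d) (e , f) = cong₂ _,_ (ℤ.+-assoc a c e) (ℤ.+-assoc b d f)

⊕-comm : ∀ p q → p ⊕ q ≡ q ⊕ p
⊕-comm (a , b) (c , d) = cong₂ _,_ (ℤ.+-comm a c) (ℤ.+-comm b d)

⊕-identityʳ : ∀ p → p ⊕ (0ℤ , 0ℤ) ≡ p
⊕-identityʳ (a , b) = cong₂ _,_ (ℤ.+-identityʳ a) (ℤ.+-identityʳ b)

⊕-cancelˡ : ∀ p q r → p ⊕ q ≡ p ⊕ r → q ≡ r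
⊕-cancelˡ (a , b) (c , d) (e , f) eq =
  cong₂ _,_ (∙-cancelˡ a c e (cong proj₁ eq)) (∙-cancelˡ b d f (cong proj₂ eq))

dist-translate : ∀ p q r → dist (p ⊕ q) (p ⊕ r) ≡ dist q r
dist-translate (a , b) (c , d) (e , f) =
  cong₂ _+_ (cong ∣_∣ ([a+e]-[a+c]≡e-c a c e)) (cong ∣_∣ ([a+e]-[a+c]≡e-c b d f))
  where [a+e]-[a+c]≡e-c : ∀ a c e → (a ℤ.+ e) - (a ℤ.+ c) ≡ e - c
        [a+e]-[a+c]≡e-c = solve-∀

translate : V → (Fin k → V) → Fin k → V
translate p c i = p ⊕ c i

translate-injective : ∀ p (c : Fin k → V) → Injective _≡_ _≡_ c → Injective _≡_ _≡_ (translate p c)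
translate-injective p c injective = injective ∘ ⊕-cancelˡ p _ _

translate-noThreeBetween : ∀ p (c : Fin k → V) → NoThreeBetween c → NoThreeBetween (translate p c)
translate-noThreeBetween p c noBetween i j l i≢j j≢l i≢l (between eq) =
  noBetween i j l i≢j j≢l i≢l $ between $ subst₂ _≡_
    (cong₂ _+_ (dist-translate p (c i) (c j)) (dist-translate p (c j) (c l)))
    (dist-translate p (c i) (c l)) eq

adj-irreflexive : ¬ Adj u u
adj-irreflexive {u} u∼u = 0≢1+n (trans (sym (dist-self u)) (adj⇒dist≡1 u∼u))

legalMove : (c c′ : Fin k → V) (i : Fin k) → Adj (c i) (c′ i) → (∀ j → j ≢ i → c′ j ≡ c j) →
  GeneralPosition c′ → LegalMove c c′
legalMove c c′ i ci∼c′i unchanged gp = i , c′ i , ci∼c′i , vacant , refl , unchanged , gp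
  where
  vacant : ∀ j → c j ≢ c′ i
  vacant j cj≡c′i with j ≟ᶠ i
  ... | yes refl = adj-irreflexive (subst (Adj (c i)) (sym cj≡c′i) ci∼c′i)
  ... | no j≢i   = j≢i (proj₁ gp (trans (unchanged j j≢i) cj≡c′i))

translate-generalPosition : ∀ p (s : Fin k → V) → Separated s → GeneralPosition (translate p s)
translate-generalPosition p s (injective , noBetween) =
  Equivalence.from (generalPosition⇔separated (translate p s))
    (translate-injective p s injective , translate-noThreeBetween p s noBetween)

shiftAt : Direction → Fin k → (Fin k → V) → Fin k → V
shiftAt d i s = updateAt s i (_⊕ unit d)

shiftAt-legal : ∀ p d i (s : Fin k → V) → Separated (shiftAt d i s) →
  LegalMove (translate p s) (translate p (shiftAt d i s))
shiftAt-legal p d i s separated =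
  legalMove (translate p s) (translate p (shiftAt d i s)) i adj unchanged
    (translate-generalPosition p (shiftAt d i s) separated)
  where
  adj : Adj (p ⊕ s i) (p ⊕ shiftAt d i s i)
  adj = subst (Adj (p ⊕ s i))
    (trans (⊕-assoc p (s i) (unit d)) (cong (p ⊕_) (sym (updateAt-updates i s))))
    (adj-unit (p ⊕ s i) d)
  unchanged : ∀ j → j ≢ i → p ⊕ shiftAt d i s j ≡ p ⊕ s j
  unchanged j j≢i = cong (p ⊕_) (updateAt-minimal j i s j≢i)

infix 4 _≟ᵥ_
_≟ᵥ_ : DecidableEquality V
_≟ᵥ_ = ≡-dec ℤ._≟_ ℤ._≟_

between? : ∀ x y z → Dec (Between x y z)
between? x y z = map′ between Between.dist-≡ (dist x y + dist y z ≟ⁿ dist x z)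

injective? : (c : Fin k → V) → Dec (Injective _≡_ _≡_ c)
injective? c = map′ (λ inj {i} {j} → inj i j) (λ inj i j → inj {i} {j})
  (all? λ i → all? λ j → (c i ≟ᵥ c j) →-dec (i ≟ᶠ j))

noThreeBetween? : (c : Fin k → V) → Dec (NoThreeBetween c)
noThreeBetween? c = all? λ i → all? λ j → all? λ l →
  ¬? (i ≟ᶠ j) →-dec ¬? (j ≟ᶠ l) →-dec ¬? (i ≟ᶠ l) →-dec ¬? (between? (c i) (c j) (c l))

separated? : (c : Fin k → V) → Dec (Separated c)
separated? c = injective? c ×-dec noThreeBetween? c

shiftAll : Direction → List (Fin k) → (Fin k → V) → Fin k → V
shiftAll d []       s = s
shiftAll d (i ∷ is) s = shiftAll d is (shiftAt d i s)

Admissible : Direction → List (Fin k) → (Fin k → V) → Set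
Admissible d []       s = ⊤
Admissible d (i ∷ is) s = Separated (shiftAt d i s) × Admissible d is (shiftAt d i s)

admissible? : ∀ d is (s : Fin k → V) → Dec (Admissible d is s)
admissible? d []       s = yes tt
admissible? d (i ∷ is) s =
  separated? (shiftAt d i s) ×-dec admissible? d is (shiftAt d i s)

shiftAll-run : ∀ p d is (s : Fin k → V) → Admissible d is s →
  Star Step (translate p s) (translate p (shiftAll d is s))
shiftAll-run p d []       s tt                 = ε
shiftAll-run p d (i ∷ is) s (separated , rest) =
  inj₁ (shiftAt-legal p d i s separated) ◅ shiftAll-run p d is (shiftAt d i s) rest

formation : Fin 4 → V
formation 0F = (-[1+ 2 ] , -[1+ 1 ])
formation 1F = (-[1+ 1 ] , -[1+ 2 ])
formation 2F = (-[1+ 0 ] , + 1)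
formation 3F = (+ 0 , + 0)

schedule : Direction → List (Fin 4)
schedule east  = 1F ∷ 0F ∷ 3F ∷ 2F ∷ []
schedule south = 1F ∷ 0F ∷ 3F ∷ 2F ∷ []
schedule west  = 0F ∷ 1F ∷ 2F ∷ 3F ∷ []
schedule north = 0F ∷ 1F ∷ 2F ∷ 3F ∷ []

ValidSchedule : Direction → Set
ValidSchedule d = Admissible d (schedule d) formation ×
                  (∀ i → shiftAll d (schedule d) formation i ≡ formation i ⊕ unit d)

validSchedule? : ∀ d → Dec (ValidSchedule d)
validSchedule? d = admissible? d (schedule d) formation ×-dec
                   all? λ i → shiftAll d (schedule d) formation i ≟ᵥ formation i ⊕ unit d

schedule-valid : ∀ d → ValidSchedule d
schedule-valid east  = from-yes (validSchedule? east)
schedule-valid west  = from-yes (validSchedule? west)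
schedule-valid north = from-yes (validSchedule? north)
schedule-valid south = from-yes (validSchedule? south)

formation-separated : Separated formation
formation-separated = from-yes (separated? formation)

placed : V → Fin 4 → V
placed p = translate p formation

-- The final idle step only replaces the configuration by a pointwise equal one.
step-run : ∀ p d → Star Step (placed p) (placed (p ⊕ unit d))
step-run p d =
  shiftAll-run p d (schedule d) formation (proj₁ (schedule-valid d)) ◅◅ inj₂ realigned ◅ ε
  where
  open ≡-Reasoning
  realigned : ∀ i → p ⊕ unit d ⊕ formation i ≡ p ⊕ shiftAll d (schedule d) formation i
  realigned i = begin
    p ⊕ unit d ⊕ formation i                 ≡⟨ ⊕-assoc p (unit d) (formation i) ⟩
    p ⊕ (unit d ⊕ formation i)               ≡⟨ cong (p ⊕_) (⊕-comm (unit d) (formation i)) ⟩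
    p ⊕ (formation i ⊕ unit d)               ≡⟨ cong (p ⊕_) (proj₂ (schedule-valid d) i) ⟨
    p ⊕ shiftAll d (schedule d) formation i  ∎

travel : ∀ p L → Star Step (placed p) (placed (follow p L))
travel p []      = ε
travel p (d ∷ L) = step-run p d ◅◅ travel (p ⊕ unit d) L

travel-to : ∀ p q → Star Step (placed p) (placed q)
travel-to p q = subst (Star Step (placed p) ∘ placed) (follow-route p q) (travel p (route p q))

-- Visiting every vertex

-- Between two consecutive legs the walk idles for one step (R-refl).
module Concatenation
  {A : Set} {R : A → A → Set} (R-refl : ∀ {x} → R x x)
  (milestone : ℕ → A) (leg : ∀ n → Star R (milestone n) (milestone (suc n)))
  where

  record Progress : Set where
    constructor progress
    field
      current   : ℕ
      position  : A
      remaining : Star R position (milestone (suc current))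

  advance : Progress → Progress
  advance (progress n _ ε)          = progress (suc n) (milestone (suc n)) (leg (suc n))
  advance (progress n _ (_ ◅ rest)) = progress n _ rest

  progress-at : ℕ → Progress
  progress-at zero    = progress 0 (milestone 0) (leg 0)
  progress-at (suc t) = advance (progress-at t)

  walk : ℕ → A
  walk = Progress.position ∘ progress-at

  advance-step : ∀ π → R (Progress.position π) (Progress.position (advance π))
  advance-step (progress _ _ ε)       = R-refl
  advance-step (progress _ _ (r ◅ _)) = r

  walk-step : ∀ t → R (walk t) (walk (suc t))
  walk-step t = advance-step (progress-at t)

  reaches-leg : ∀ n → ∃ λ t → progress-at t ≡ progress n (milestone n) (leg n)
  reaches-leg zero    = 0 , refl
  reaches-leg (suc n) = finish {proj₁ (reaches-leg n)} (leg n) (proj₂ (reaches-leg n))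
    where
    finish : ∀ {t x} (rest : Star R x (milestone (suc n))) → progress-at t ≡ progress n x rest →
             ∃ λ t′ → progress-at t′ ≡ progress (suc n) (milestone (suc n)) (leg (suc n))
    finish {t} ε          reached = suc t , cong advance reached
    finish {t} (_ ◅ rest) reached = finish {suc t} rest (cong advance reached)

  walk-visits : ∀ n → ∃ λ t → walk t ≡ milestone n
  walk-visits n = Product.map₂ (cong Progress.position) (reaches-leg n)

zigzag : ℕ → ℤ
zigzag zero          = + 0
zigzag (suc zero)    = -[1+ 0 ]
zigzag (suc (suc n)) = outward (zigzag n)
  where
  outward : ℤ → ℤ
  outward (+ m)    = + suc m
  outward -[1+ m ] = -[1+ suc m ]

twice : ℕ → ℕ
twice zero    = zero
twice (suc m) = suc (suc (twice m))

zigzag-twice : ∀ m → zigzag (twice m) ≡ + m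
zigzag-twice zero    = refl
zigzag-twice (suc m) rewrite zigzag-twice m = refl

zigzag-suc-twice : ∀ m → zigzag (suc (twice m)) ≡ -[1+ m ]
zigzag-suc-twice zero    = refl
zigzag-suc-twice (suc m) rewrite zigzag-suc-twice m = refl

zigzag-surjective : ∀ a → ∃ λ m → zigzag m ≡ a
zigzag-surjective (+ m)    = twice m , zigzag-twice m
zigzag-surjective -[1+ m ] = suc (twice m) , zigzag-suc-twice m

nextOnDiagonal : ℕ × ℕ → ℕ × ℕ
nextOnDiagonal (x , zero)  = (zero , suc x)
nextOnDiagonal (x , suc y) = (suc x , y)

unpair : ℕ → ℕ × ℕ
unpair zero    = (0 , 0)
unpair (suc n) = nextOnDiagonal (unpair n)

unpair-along-diagonal : ∀ x y n → unpair n ≡ (0 , x + y) → unpair (x + n) ≡ (x , y)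
unpair-along-diagonal zero    y n reached = reached
unpair-along-diagonal (suc x) y n reached = cong nextOnDiagonal
  (unpair-along-diagonal x (suc y) n (trans reached (cong (0 ,_) (sym (+-suc x y)))))

unpair-diagonal-start : ∀ s → ∃ λ n → unpair n ≡ (0 , s)
unpair-diagonal-start zero    = 0 , refl
unpair-diagonal-start (suc s) with unpair-diagonal-start s
... | n , reached = suc (s + n) , cong nextOnDiagonal
  (unpair-along-diagonal s 0 n (trans reached (cong (0 ,_) (sym (+-identityʳ s)))))

unpair-surjective : ∀ x y → ∃ λ n → unpair n ≡ (x , y)
unpair-surjective x y with unpair-diagonal-start (x + y)
... | n , reached = x + n , unpair-along-diagonal x y n reached

enumerate : ℕ → V
enumerate = Product.map zigzag zigzag ∘ unpair

enumerate-surjective : ∀ p → ∃ λ n → enumerate n ≡ p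
enumerate-surjective (a , b) with zigzag-surjective a | zigzag-surjective b
... | x , refl | y , refl with unpair-surjective x y
... | n , unpair≡ = n , cong (Product.map zigzag zigzag) unpair≡

formation-mobile : Mobile (placed (enumerate 0))
formation-mobile =
  translate-generalPosition (enumerate 0) formation formation-separated ,
  walk , (λ _ → refl) , walk-step , visits
  where
  open Concatenation {R = Step} (inj₂ λ _ → refl) (placed ∘ enumerate)
                     (λ n → travel-to (enumerate n) (enumerate (suc n)))
  visits : ∀ w → Σ ℕ λ t → Σ (Fin 4) λ i → walk t i ≡ w
  visits w with enumerate-surjective w
  ... | n , refl with walk-visits n
  ... | t , walk≡ = t , 3F , trans (cong-app walk≡ 3F) (⊕-identityʳ (enumerate n))

theorem3p3 : Σ (Fin 4 → V) (λ S → Mobile S) ×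
    (∀ (k : ℕ) (S : Fin k → V) → Mobile S → k ≤ 4)
theorem3p3 =
  (placed (enumerate 0) , formation-mobile) , λ k S mobile → generalPosition⇒≤4 S (proj₁ mobile)
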